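{- Let $N=\{1,\dots,n\}$ be a set of agents and $O$ a set of objects in the house allocation model, each agent $i$ having a strict ranking $\succ_i$ over its acceptable objects. Let $M$ be a matching and $k\in\mathbb{N}$. Then $M$ is $k$-stable if and only if the improvement graph $G_M$ does not admit a matching of size at least $k$. In particular, $M$ is majority stable if and only if $G_M$ does not admit a matching of size at least $\frac{n+1}{2}$.
   Context: House allocation model: a finite set of agents $N=\{1,\dots,n\}$ and a finite set of objects $O$; each agent $i$ has a strict linear order $\succ_i$ over a subset of $O$ (its acceptable objects); objects have no preferences. A matching is a set of agent–object pairs $(i,o)$ with $o$ acceptable to $i$ such that each agent and each object lies in at most one pair; $M(i)$ denotes the object assigned to $i$ (possibly none). Every agent strictly prefers any acceptable object to being unmatched, and $M'(i)\succ_i M(i)$ is interpreted accordingly. A matching $M$ is $k$-stable if there is no matching $M'$ with $|\{i\in N: M'(i)\succ_i M(i)\}|\ge k$; $M$ is majority stable if it is $\frac{n+1}{2}$-stable. The improvement graph $G_M$ is the bipartite graph on vertex set $N\cup O$ with an edge $(i,o)$ if and only if $o$ is acceptable to $i$ and $o\succ_i M(i)$. -}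

module Defs where

open import Data.Nat using (ℕ; suc; _/_)
open import Data.Fin using (Fin)
open import Data.List using (List; _∷_; _++_)
open import Data.List.Membership.Propositional using (_∈_)
open import Data.Maybe using (Maybe; just; nothing; Is-just)
open import Data.Product using (Σ; _×_; ∃)
open import Data.Empty using (⊥)
open import Relation.Binary.PropositionalEquality using (_≡_)
open import Relation.Nullary using (¬_)
open import Function.Definitions using (Injective)

-- A preference profile for n agents over m objects: agent i's list of
-- acceptable objects, best first.  Strictness of the ranking is imposed
-- separately (the list has no repetitions).
Prefs : ℕ → ℕ → Set
Prefs n m = Fin n → List (Fin m)

Before : {m : ℕ} → List (Fin m) → Fin m → Fin m → Set
Before ℓ o o' = Σ (List _) λ xs → Σ (List _) λ ys → (ℓ ≡ xs ++ (o ∷ ys)) × (o' ∈ ys)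

-- "mo' ≻_i mo" for possibly-unmatched outcomes: mo' is an acceptable
-- object, and either mo is "unmatched" or mo' is ranked strictly above mo.
Prefers : {n m : ℕ} → Prefs n m → Fin n → Maybe (Fin m) → Maybe (Fin m) → Set
Prefers P i nothing   _          = ⊥
Prefers P i (just o') nothing    = o' ∈ P i
Prefers P i (just o') (just o)   = Before (P i) o' o

-- A matching of a bipartite graph with edge relation E between agents and
-- objects, represented as a partial assignment agent ↦ object that uses
-- only edges of E and assigns each object to at most one agent.
IsMatchingIn : {n m : ℕ} → (Fin n → Fin m → Set) → (Fin n → Maybe (Fin m)) → Set
IsMatchingIn {n} {m} E M =
  (∀ (i : Fin n) (o : Fin m) → M i ≡ just o → E i o) ×
  (∀ (i j : Fin n) (o : Fin m) → M i ≡ just o → M j ≡ just o → i ≡ j)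

Acceptable : {n m : ℕ} → Prefs n m → Fin n → Fin m → Set
Acceptable P i o = o ∈ P i

IsMatching : {n m : ℕ} → Prefs n m → (Fin n → Maybe (Fin m)) → Set
IsMatching P M = IsMatchingIn (Acceptable P) M

AtLeast : {n : ℕ} → ℕ → (Fin n → Set) → Set
AtLeast {n} k Q = Σ (Fin k → Fin n) λ f → Injective _≡_ _≡_ f × (∀ j → Q (f j))

KStable : {n m : ℕ} → Prefs n m → ℕ → (Fin n → Maybe (Fin m)) → Set
KStable {n} {m} P k M =
  ∀ (M' : Fin n → Maybe (Fin m)) → IsMatching P M' →
    ¬ AtLeast k (λ i → Prefers P i (M' i) (M i))

-- Majority stable: (n+1)/2-stable.  Since |…| is an integer, "≥ (n+1)/2"
-- is "≥ ⌈(n+1)/2⌉" and ⌈(n+1)/2⌉ = ⌊n/2⌋ + 1.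
MajorityThreshold : ℕ → ℕ
MajorityThreshold n = suc (n / 2)

MajorityStable : {n m : ℕ} → Prefs n m → (Fin n → Maybe (Fin m)) → Set
MajorityStable {n} P M = KStable P (MajorityThreshold n) M

ImprovementEdge : {n m : ℕ} → Prefs n m → (Fin n → Maybe (Fin m)) → Fin n → Fin m → Set
ImprovementEdge P M i o = Acceptable P i o × Prefers P i (just o) (M i)

HasMatchingOfSizeAtLeast : {n m : ℕ} → (Fin n → Fin m → Set) → ℕ → Set
HasMatchingOfSizeAtLeast {n} {m} E k =
  Σ (Fin n → Maybe (Fin m)) λ M' → IsMatchingIn E M' × AtLeast k (λ i → Is-just (M' i))

-- A matching of G_M is a matching of the instance in which every matched
-- agent is better off than under M.  Conversely, if a matching M' makes
-- k agents better off, restricting M' to those k agents gives a matching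
-- of G_M of size k: each kept edge is an improvement edge, and restriction
-- cannot break the matching property.
module Submission where

open import Defs
open import Level using (0ℓ)
open import Data.Nat using (ℕ)
open import Data.Fin using (Fin)
open import Data.Fin.Properties using (any?; _≟_)
open import Data.Maybe using (Maybe; just; nothing; Is-just)
open import Data.Maybe.Relation.Unary.Any using (just)
open import Data.Product using (_×_; _,_; ∃; proj₁; proj₂)
open import Data.Unit using (tt)
open import Data.List.Relation.Unary.Unique.Propositional using (Unique)
open import Relation.Nullary using (¬_; yes; no; contradiction)
open import Relation.Unary using (Pred; Decidable)
open import Relation.Binary using (_⇒_)
open import Relation.Binary.PropositionalEquality using (_≡_; refl; subst)
open import Function.Bundles using (_⇔_; mk⇔)

private
  variable
    n m : ℕ

isMatchingIn-mono : {E F : Fin n → Fin m → Set} → E ⇒ F →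
  ∀ {M} → IsMatchingIn E M → IsMatchingIn F M
isMatchingIn-mono E⇒F (edges , inj) = (λ i o eq → E⇒F (edges i o eq)) , inj

prefers⇒Is-just : (P : Prefs n m) (i : Fin n) (x y : Maybe (Fin m)) →
  Prefers P i x y → Is-just x
prefers⇒Is-just P i (just o) y _ = just tt

AtLeast-mono : {k : ℕ} {Q R : Fin n → Set} → (∀ i → Q i → R i) →
  AtLeast k Q → AtLeast k R
AtLeast-mono Q⇒R (f , f-inj , Qf) = f , f-inj , λ j → Q⇒R (f j) (Qf j)

module _ {A : Set} {S : Pred (Fin n) 0ℓ} (S? : Decidable S) where

  restrict : (Fin n → Maybe A) → Fin n → Maybe A
  restrict M i with S? i
  ... | yes _ = M i
  ... | no  _ = nothing

  restrict-≡just : ∀ M i {a} → restrict M i ≡ just a → S i × M i ≡ just a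
  restrict-≡just M i eq with S? i
  ... | yes Si = Si , eq

  restrict-on : ∀ M {i} → S i → restrict M i ≡ M i
  restrict-on M {i} Si with S? i
  ... | yes _   = refl
  ... | no  ¬Si = contradiction Si ¬Si

module _ (P : Prefs n m) (M : Fin n → Maybe (Fin m)) where

  matched-improves : ∀ {M'} → IsMatchingIn (ImprovementEdge P M) M' →
    ∀ i → Is-just (M' i) → Prefers P i (M' i) (M i)
  matched-improves {M'} (edges , _) i _ with M' i in eq
  ... | just o = proj₂ (edges i o eq)

  restrict-improvement-matching : ∀ {S : Pred (Fin n) 0ℓ} (S? : Decidable S) {M'} →
    IsMatching P M' → (∀ i → S i → Prefers P i (M' i) (M i)) →
    IsMatchingIn (ImprovementEdge P M) (restrict S? M')
  restrict-improvement-matching S? {M'} (acceptable , inj) improves =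
    edges , λ i j o eqᵢ eqⱼ → inj i j o (kept i eqᵢ) (kept j eqⱼ)
    where
    kept : ∀ i {o} → restrict S? M' i ≡ just o → M' i ≡ just o
    kept i eq = proj₂ (restrict-≡just S? M' i eq)

    edges : ∀ i o → restrict S? M' i ≡ just o → ImprovementEdge P M i o
    edges i o eq with restrict-≡just S? M' i eq
    ... | Si , M'i≡o =
      acceptable i o M'i≡o , subst (λ x → Prefers P i x (M i)) M'i≡o (improves i Si)

  kStable⇒¬improvementMatching : ∀ k →
    KStable P k M → ¬ HasMatchingOfSizeAtLeast (ImprovementEdge P M) k
  kStable⇒¬improvementMatching k stable (M' , matching , size) =
    stable M' (isMatchingIn-mono proj₁ matching)
      (AtLeast-mono (matched-improves matching) size)

  ¬improvementMatching⇒kStable : ∀ k →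
    ¬ HasMatchingOfSizeAtLeast (ImprovementEdge P M) k → KStable P k M
  ¬improvementMatching⇒kStable k noMatching M' matching (f , f-inj , improves) =
    noMatching (restrict inImage? M' , improvementMatching , f , f-inj , matchedAt)
    where
    inImage? : Decidable (λ i → ∃ λ j → f j ≡ i)
    inImage? i = any? (λ j → f j ≟ i)

    improvementMatching : IsMatchingIn (ImprovementEdge P M) (restrict inImage? M')
    improvementMatching =
      restrict-improvement-matching inImage? matching λ { _ (j , refl) → improves j }

    matchedAt : ∀ j → Is-just (restrict inImage? M' (f j))
    matchedAt j rewrite restrict-on inImage? M' (j , refl) =
      prefers⇒Is-just P (f j) (M' (f j)) (M (f j)) (improves j)

  kStable⇔¬improvementMatching : ∀ k →
    KStable P k M ⇔ (¬ HasMatchingOfSizeAtLeast (ImprovementEdge P M) k)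
  kStable⇔¬improvementMatching k =
    mk⇔ (kStable⇒¬improvementMatching k) (¬improvementMatching⇒kStable k)

mainTheorem1 : ∀ (n m : ℕ) (P : Prefs n m) → (∀ i → Unique (P i)) →
    (M : Fin n → Maybe (Fin m)) → IsMatching P M →
    (∀ (k : ℕ) → KStable P k M ⇔ (¬ HasMatchingOfSizeAtLeast (ImprovementEdge P M) k)) ×
    (MajorityStable P M ⇔ (¬ HasMatchingOfSizeAtLeast (ImprovementEdge P M) (MajorityThreshold n)))
mainTheorem1 n m P _ M _ =
  kStable⇔¬improvementMatching P M , kStable⇔¬improvementMatching P M (MajorityThreshold n)
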